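{- For $v\in\{75,105\}$, $(\frac{v-3}{2},1)\in\mathrm{HWP}(v;3,5)$; that is, $K_v$ has a 2-factorization consisting of exactly $\frac{v-3}{2}$ $C_3$-factors and $1$ $C_5$-factor.
   Context: A $C_k$-factor of a graph is a spanning subgraph all of whose components are cycles of length $k$. A 2-factorization is a partition of the edge set into 2-factors. $\mathrm{HWP}(v;m,n)$ is the set of pairs $(\alpha,\beta)$ such that $K_v$ ($v$ odd) or $K_v$ minus a 1-factor ($v$ even) has a 2-factorization into exactly $\alpha$ $C_m$-factors and $\beta$ $C_n$-factors. -}

module Defs where

open import Data.Nat using (ℕ; zero; suc)
open import Data.Fin using (Fin; toℕ)
open import Data.Product using (Σ; ∃; ∃-syntax; _×_; _,_; uncurry)
open import Data.Sum using (_⊎_; inj₁; inj₂)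
open import Relation.Binary.PropositionalEquality using (_≡_)
open import Relation.Nullary using (¬_)
open import Function.Definitions using (Bijective)

-- A C_k-factor of K_v (vertex set Fin v): some number r of k-cycles,
-- cycle j visiting vertices cyc j 0, cyc j 1, ..., cyc j (k-1) (and back),
-- such that (j , i) ↦ cyc j i is a bijection Fin r × Fin k → Fin v
-- (so the cycles are vertex-disjoint, each has k distinct vertices, and
-- together they span all v vertices).
record CFactor (k v : ℕ) : Set where
  field
    r        : ℕ
    cyc      : Fin r → Fin k → Fin v
    bijective : Bijective _≡_ _≡_ (uncurry cyc)

Consecutive : {k : ℕ} → Fin k → Fin k → Set
Consecutive {k} i j = (toℕ j ≡ suc (toℕ i)) ⊎ ((toℕ j ≡ 0) × (suc (toℕ i) ≡ k))

EdgeOf : {k v : ℕ} → CFactor k v → Fin v → Fin v → Set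
EdgeOf {k} F x y =
  ∃[ c ] ∃[ i ] ∃[ j ] Consecutive {k} i j ×
    (((cyc c i ≡ x) × (cyc c j ≡ y)) ⊎ ((cyc c i ≡ y) × (cyc c j ≡ x)))
  where open CFactor F

EdgeIn : {v m n α β : ℕ} → (Fin α → CFactor m v) → (Fin β → CFactor n v) →
         Fin α ⊎ Fin β → Fin v → Fin v → Set
EdgeIn F G (inj₁ a) x y = EdgeOf (F a) x y
EdgeIn F G (inj₂ b) x y = EdgeOf (G b) x y

-- A 2-factorization of K_v (v odd: the complete graph itself) into exactly
-- α C_m-factors and β C_n-factors: the factors are indexed by Fin α ⊎ Fin β,
-- and every edge {x , y} (x ≢ y) of K_v lies in exactly one factor.
record TwoFactorization (v m n α β : ℕ) : Set where
  field
    mFactor : Fin α → CFactor m v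
    nFactor : Fin β → CFactor n v
    covers  : (x y : Fin v) → ¬ (x ≡ y) → ∃[ f ] EdgeIn mFactor nFactor f x y
    unique  : (x y : Fin v) → (f g : Fin α ⊎ Fin β) →
              EdgeIn mFactor nFactor f x y → EdgeIn mFactor nFactor g x y → f ≡ g

-- Take the vertex set Z_3 × Z_M with M = v/3, the vertex x being (x / M, x % M).
-- Translating one base triangle factor by the elements of Z_M gives M triangle
-- factors; the remaining triangle factors consist of the translation-invariant
-- transversals {(0,c), (1,c+s), (2,c+2s)} for suitable slopes s, and the
-- C_5-factor consists of the cosets of the subgroup of order 5 of Z_M in each
-- layer.  Every Z_M-orbit of edges then lies in exactly one invariant factor or
-- meets the base factor in exactly one edge, which determines the factor of
-- every edge; the resulting finite conditions are checked by evaluation.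
module Submission where

open import Defs
open import Data.Bool using (Bool; true; false; T; _∧_; _∨_; if_then_else_)
open import Data.Bool.Properties using (T-∧; T-∨)
open import Data.Empty using (⊥-elim)
open import Data.Unit using (tt)
open import Data.Fin using (Fin; toℕ; fromℕ<; join; splitAt)
open import Data.Fin.Properties
  using (toℕ<n; toℕ-injective; toℕ-fromℕ<; toℕ-↑ˡ; toℕ-↑ʳ; splitAt-join)
open import Data.List using (List; []; _∷_; length)
open import Data.Nat using (ℕ; zero; suc; _+_; _*_; _∸_; _<_; z≤n; _≡ᵇ_; _<ᵇ_; _≤ᵇ_; NonZero)
open import Data.Nat.DivMod using (_/_; _%_)
open import Data.Nat.Properties
  using (_≟_; ≡ᵇ⇒≡; <ᵇ⇒<; <ᵇ-reflects-<; <-irrefl; ≤-<-trans; ≤∧≢⇒<; m<1+n⇒m<n∨m≡n; m*n≢0)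
open import Data.Product using (∃-syntax; _×_; _,_; proj₁; proj₂; uncurry)
open import Data.Sum using (_⊎_; inj₁; inj₂)
open import Function.Bundles using (Equivalence)
open import Function.Definitions using (Injective; Surjective)
open import Relation.Binary.PropositionalEquality using (_≡_; refl; sym; trans; cong; cong₂; subst)
open import Relation.Nullary using (¬_; proof; ofʸ; ofⁿ)

open Equivalence using (to)

allBelow : ℕ → (ℕ → Bool) → Bool
allBelow zero    p = true
allBelow (suc n) p = p n ∧ allBelow n p

allBelow-sound : ∀ {n p} → T (allBelow n p) → ∀ {m} → m < n → T (p m)
allBelow-sound {suc n} h m<1+n with m<1+n⇒m<n∨m≡n m<1+n
... | inj₁ m<n  = allBelow-sound (proj₂ (to T-∧ h)) m<n
... | inj₂ refl = proj₁ (to T-∧ h)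

entry : List ℕ → ℕ → ℕ
entry []       _       = 0
entry (x ∷ xs) zero    = x
entry (x ∷ xs) (suc i) = entry xs i

next : ℕ → ℕ → ℕ
next k i = if suc i ≡ᵇ k then 0 else suc i

-- proof (m ≟ n) reflects m ≡ n in the boolean m ≡ᵇ n, so matching on both unfolds next.
next-< : ∀ {k i} → i < k → next k i < k
next-< {k} {i} i<k with suc i ≡ᵇ k | proof (suc i ≟ k)
... | true  | _          = ≤-<-trans z≤n i<k
... | false | ofⁿ 1+i≢k = ≤∧≢⇒< i<k 1+i≢k

Consecutive⇒next : ∀ {k} {i j : Fin k} → Consecutive i j → toℕ j ≡ next k (toℕ i)
Consecutive⇒next {k} {i} {j} ij with suc (toℕ i) ≡ᵇ k | proof (suc (toℕ i) ≟ k) | ij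
... | true  | ofʸ 1+i≡k | inj₁ j≡1+i       = ⊥-elim (<-irrefl (trans j≡1+i 1+i≡k) (toℕ<n j))
... | true  | _         | inj₂ (j≡0 , _)   = j≡0
... | false | _         | inj₁ j≡1+i       = j≡1+i
... | false | ofⁿ 1+i≢k | inj₂ (_ , 1+i≡k) = ⊥-elim (1+i≢k 1+i≡k)

next⇒Consecutive : ∀ {k} {i j : Fin k} → toℕ j ≡ next k (toℕ i) → Consecutive i j
next⇒Consecutive {k} {i} j≡next with suc (toℕ i) ≡ᵇ k | proof (suc (toℕ i) ≟ k)
... | true  | ofʸ 1+i≡k = inj₂ (j≡next , 1+i≡k)
... | false | _         = inj₁ j≡next

-- A candidate C_k-factor given by ℕ-valued tables; the claimed inverse coordinates
-- cycleOf and position make bijectivity and adjacency checkable by evaluation.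
record CycleTable : Set where
  field
    cycles   : ℕ
    vertex   : ℕ → ℕ → ℕ
    cycleOf  : ℕ → ℕ
    position : ℕ → ℕ

module _ (k : ℕ) (t : CycleTable) where
  open CycleTable t

  isCycleFactor : ℕ → Bool
  isCycleFactor v =
    allBelow cycles (λ c → allBelow k (λ i →
      (vertex c i <ᵇ v) ∧ (cycleOf (vertex c i) ≡ᵇ c) ∧ (position (vertex c i) ≡ᵇ i)))
    ∧ allBelow v (λ x →
      (cycleOf x <ᵇ cycles) ∧ (position x <ᵇ k) ∧ (vertex (cycleOf x) (position x) ≡ᵇ x))

  successor : ℕ → ℕ
  successor x = vertex (cycleOf x) (next k (position x))

  adjacent : ℕ → ℕ → Bool
  adjacent x y = (successor x ≡ᵇ y) ∨ (successor y ≡ᵇ x)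

  hasEdgeLabel : (ℕ → ℕ → ℕ) → ℕ → Bool
  hasEdgeLabel label l = allBelow cycles (λ c → allBelow k (λ i →
    (label (vertex c i) (vertex c (next k i)) ≡ᵇ l) ∧ (label (vertex c (next k i)) (vertex c i) ≡ᵇ l)))

module CycleTableSound {k v : ℕ} (t : CycleTable) (valid : T (isCycleFactor k t v)) where
  open CycleTable t

  private
    vertex-spec : ∀ {c i} → c < cycles → i < k →
      T (vertex c i <ᵇ v) × T (cycleOf (vertex c i) ≡ᵇ c) × T (position (vertex c i) ≡ᵇ i)
    vertex-spec c<r i<k =
      let bound , inverse = to T-∧ (allBelow-sound (allBelow-sound (proj₁ (to T-∧ valid)) c<r) i<k)
      in bound , to T-∧ inverse

    coordinates-spec : ∀ {x} → x < v →
      T (cycleOf x <ᵇ cycles) × T (position x <ᵇ k) × T (vertex (cycleOf x) (position x) ≡ᵇ x)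
    coordinates-spec x<v =
      let c-bound , rest = to T-∧ (allBelow-sound (proj₂ (to T-∧ valid)) x<v)
      in c-bound , to T-∧ rest

  vertex-< : ∀ {c i} → c < cycles → i < k → vertex c i < v
  vertex-< c<r i<k = <ᵇ⇒< _ _ (proj₁ (vertex-spec c<r i<k))

  cycleOf-vertex : ∀ {c i} → c < cycles → i < k → cycleOf (vertex c i) ≡ c
  cycleOf-vertex c<r i<k = ≡ᵇ⇒≡ _ _ (proj₁ (proj₂ (vertex-spec c<r i<k)))

  position-vertex : ∀ {c i} → c < cycles → i < k → position (vertex c i) ≡ i
  position-vertex c<r i<k = ≡ᵇ⇒≡ _ _ (proj₂ (proj₂ (vertex-spec c<r i<k)))

  cycleOf-< : ∀ {x} → x < v → cycleOf x < cycles
  cycleOf-< x<v = <ᵇ⇒< _ _ (proj₁ (coordinates-spec x<v))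

  position-< : ∀ {x} → x < v → position x < k
  position-< x<v = <ᵇ⇒< _ _ (proj₁ (proj₂ (coordinates-spec x<v)))

  vertex-coordinates : ∀ {x} → x < v → vertex (cycleOf x) (position x) ≡ x
  vertex-coordinates x<v = ≡ᵇ⇒≡ _ _ (proj₂ (proj₂ (coordinates-spec x<v)))

  cyc : Fin cycles → Fin k → Fin v
  cyc c i = fromℕ< (vertex-< (toℕ<n c) (toℕ<n i))

  toℕ-cyc : ∀ c i → toℕ (cyc c i) ≡ vertex (toℕ c) (toℕ i)
  toℕ-cyc c i = toℕ-fromℕ< _

  toℕ-cyc-fromℕ< : ∀ {c i} (c<r : c < cycles) (i<k : i < k) →
                   toℕ (cyc (fromℕ< c<r) (fromℕ< i<k)) ≡ vertex c i
  toℕ-cyc-fromℕ< c<r i<k = trans (toℕ-cyc _ _) (cong₂ vertex (toℕ-fromℕ< c<r) (toℕ-fromℕ< i<k))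

  cyc-injective : Injective _≡_ _≡_ (uncurry cyc)
  cyc-injective {c , i} {c′ , i′} eq = cong₂ _,_ (toℕ-injective same-cycle) (toℕ-injective same-position)
    where
      c<r = toℕ<n c ; i<k = toℕ<n i ; c′<r = toℕ<n c′ ; i′<k = toℕ<n i′

      same-vertex : vertex (toℕ c) (toℕ i) ≡ vertex (toℕ c′) (toℕ i′)
      same-vertex = trans (sym (toℕ-cyc c i)) (trans (cong toℕ eq) (toℕ-cyc c′ i′))

      same-cycle : toℕ c ≡ toℕ c′
      same-cycle = trans (sym (cycleOf-vertex c<r i<k))
                         (trans (cong cycleOf same-vertex) (cycleOf-vertex c′<r i′<k))

      same-position : toℕ i ≡ toℕ i′
      same-position = trans (sym (position-vertex c<r i<k))
                            (trans (cong position same-vertex) (position-vertex c′<r i′<k))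

  coordinates : Fin v → Fin cycles × Fin k
  coordinates x = fromℕ< (cycleOf-< (toℕ<n x)) , fromℕ< (position-< (toℕ<n x))

  cyc-coordinates : ∀ x → uncurry cyc (coordinates x) ≡ x
  cyc-coordinates x = toℕ-injective (trans (toℕ-cyc-fromℕ< (cycleOf-< x<v) (position-< x<v)) (vertex-coordinates x<v))
    where x<v = toℕ<n x

  cyc-surjective : Surjective _≡_ _≡_ (uncurry cyc)
  cyc-surjective x = coordinates x , λ { refl → cyc-coordinates x }

  factor : CFactor k v
  factor = record { r = cycles ; cyc = cyc ; bijective = cyc-injective , cyc-surjective }

  Arc : Fin v → Fin v → Set
  Arc x y = ∃[ c ] ∃[ i ] ∃[ j ] Consecutive i j × cyc c i ≡ x × cyc c j ≡ y

  successor⇒Arc : ∀ x y → T (successor k t (toℕ x) ≡ᵇ toℕ y) → Arc x y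
  successor⇒Arc x y succ≡y = c , i , j , next⇒Consecutive j≡next , cyc-coordinates x , cyc-c-j≡y
    where
      c = proj₁ (coordinates x)
      i = proj₂ (coordinates x)
      x<v = toℕ<n x
      j = fromℕ< (next-< (position-< x<v))

      j≡next : toℕ j ≡ next k (toℕ i)
      j≡next = trans (toℕ-fromℕ< _) (cong (next k) (sym (toℕ-fromℕ< _)))

      cyc-c-j≡y : cyc c j ≡ y
      cyc-c-j≡y = toℕ-injective (trans (toℕ-cyc-fromℕ< (cycleOf-< x<v) (next-< (position-< x<v))) (≡ᵇ⇒≡ _ _ succ≡y))

  adjacent⇒EdgeOf : ∀ x y → T (adjacent k t (toℕ x) (toℕ y)) → EdgeOf factor x y
  adjacent⇒EdgeOf x y adj with to T-∨ adj
  ... | inj₁ x→y = let c , i , j , ij , ci≡x , cj≡y = successor⇒Arc x y x→y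
                   in c , i , j , ij , inj₁ (ci≡x , cj≡y)
  ... | inj₂ y→x = let c , i , j , ij , ci≡y , cj≡x = successor⇒Arc y x y→x
                   in c , i , j , ij , inj₂ (ci≡y , cj≡x)

  module _ {label : ℕ → ℕ → ℕ} {l : ℕ} (labelled : T (hasEdgeLabel k t label l)) where
    arc-labels : ∀ c {i j} → Consecutive i j →
                 label (toℕ (cyc c i)) (toℕ (cyc c j)) ≡ l × label (toℕ (cyc c j)) (toℕ (cyc c i)) ≡ l
    arc-labels c {i} {j} ij =
      trans (cong₂ label start end) (≡ᵇ⇒≡ _ _ forward) ,
      trans (cong₂ label end start) (≡ᵇ⇒≡ _ _ backward)
      where
        start = toℕ-cyc c i
        end = trans (toℕ-cyc c j) (cong (vertex (toℕ c)) (Consecutive⇒next ij))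
        labels = to T-∧ (allBelow-sound (allBelow-sound labelled (toℕ<n c)) (toℕ<n i))
        forward = proj₁ labels
        backward = proj₂ labels

    EdgeOf⇒label : ∀ {x y} → EdgeOf factor x y → label (toℕ x) (toℕ y) ≡ l
    EdgeOf⇒label (c , i , j , ij , inj₁ (refl , refl)) = proj₁ (arc-labels c ij)
    EdgeOf⇒label (c , i , j , ij , inj₂ (refl , refl)) = proj₂ (arc-labels c ij)

record FactorizationCertificate (v m n α β : ℕ) : Set where
  field
    mTable : ℕ → CycleTable
    nTable : ℕ → CycleTable
    label  : ℕ → ℕ → ℕ

module _ {v m n α β : ℕ} (cert : FactorizationCertificate v m n α β) where
  open FactorizationCertificate cert

  coveredBy : ℕ → ℕ → ℕ → Bool
  coveredBy w x y =
    if w <ᵇ α then adjacent m (mTable w) x y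
    else (w ∸ α <ᵇ β) ∧ adjacent n (nTable (w ∸ α)) x y

  mTablesValid : Bool
  mTablesValid = allBelow α (λ a → isCycleFactor m (mTable a) v ∧ hasEdgeLabel m (mTable a) label a)

  nTablesValid : Bool
  nTablesValid = allBelow β (λ b → isCycleFactor n (nTable b) v ∧ hasEdgeLabel n (nTable b) label (α + b))

  labelsCover : Bool
  labelsCover = allBelow v (λ x → allBelow v (λ y → (x ≡ᵇ y) ∨ coveredBy (label x y) x y))

  isValid : Bool
  isValid = mTablesValid ∧ nTablesValid ∧ labelsCover

module FactorizationSound {v m n α β : ℕ} (cert : FactorizationCertificate v m n α β)
                          (valid : T (isValid cert)) where
  open FactorizationCertificate cert

  private
    parts : T (mTablesValid cert) × T (nTablesValid cert) × T (labelsCover cert)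
    parts = let m-valid , rest = to (T-∧ {mTablesValid cert}) valid
            in m-valid , to (T-∧ {nTablesValid cert}) rest

    mValid : ∀ {a} → a < α →
             T (isCycleFactor m (mTable a) v) × T (hasEdgeLabel m (mTable a) label a)
    mValid a<α = to T-∧ (allBelow-sound (proj₁ parts) a<α)

    nValid : ∀ {b} → b < β →
             T (isCycleFactor n (nTable b) v) × T (hasEdgeLabel n (nTable b) label (α + b))
    nValid b<β = to T-∧ (allBelow-sound (proj₁ (proj₂ parts)) b<β)

    module M (a : Fin α) = CycleTableSound {m} {v} (mTable (toℕ a)) (proj₁ (mValid (toℕ<n a)))
    module N (b : Fin β) = CycleTableSound {n} {v} (nTable (toℕ b)) (proj₁ (nValid (toℕ<n b)))

  mFactor : Fin α → CFactor m v
  mFactor = M.factor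

  nFactor : Fin β → CFactor n v
  nFactor = N.factor

  EdgeIn⇒label : ∀ f {x y} → EdgeIn mFactor nFactor f x y →
                 label (toℕ x) (toℕ y) ≡ toℕ (join α β f)
  EdgeIn⇒label (inj₁ a) e =
    trans (M.EdgeOf⇒label a {label} (proj₂ (mValid (toℕ<n a))) e) (sym (toℕ-↑ˡ a β))
  EdgeIn⇒label (inj₂ b) e =
    trans (N.EdgeOf⇒label b {label} (proj₂ (nValid (toℕ<n b))) e) (sym (toℕ-↑ʳ α b))

  unique : ∀ x y f g → EdgeIn mFactor nFactor f x y → EdgeIn mFactor nFactor g x y → f ≡ g
  unique x y f g ef eg =
    trans (sym (splitAt-join α β f))
          (trans (cong (splitAt α) (toℕ-injective same-label)) (splitAt-join α β g))
    where same-label = trans (sym (EdgeIn⇒label f ef)) (EdgeIn⇒label g eg)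

  coveredBy⇒EdgeIn : ∀ w {x y} → T (coveredBy cert w (toℕ x) (toℕ y)) →
                     ∃[ f ] EdgeIn mFactor nFactor f x y
  coveredBy⇒EdgeIn w {x} {y} covered with w <ᵇ α | <ᵇ-reflects-< w α
  ... | true  | ofʸ w<α =
    inj₁ a , M.adjacent⇒EdgeOf a x y
               (subst (λ i → T (adjacent m (mTable i) (toℕ x) (toℕ y))) (sym (toℕ-fromℕ< w<α)) covered)
    where a = fromℕ< w<α
  ... | false | _ =
    inj₂ b , N.adjacent⇒EdgeOf b x y
               (subst (λ i → T (adjacent n (nTable i) (toℕ x) (toℕ y))) (sym (toℕ-fromℕ< b<β)) adj)
    where
      b<β = <ᵇ⇒< _ _ (proj₁ (to T-∧ covered))
      adj = proj₂ (to T-∧ covered)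
      b = fromℕ< b<β

  covers : ∀ x y → ¬ x ≡ y → ∃[ f ] EdgeIn mFactor nFactor f x y
  covers x y x≢y with to T-∨ (allBelow-sound (allBelow-sound (proj₂ (proj₂ parts)) (toℕ<n x)) (toℕ<n y))
  ... | inj₁ x≡y    = ⊥-elim (x≢y (toℕ-injective (≡ᵇ⇒≡ _ _ x≡y)))
  ... | inj₂ covered = coveredBy⇒EdgeIn (label (toℕ x) (toℕ y)) covered

  factorization : TwoFactorization v m n α β
  factorization = record { mFactor = mFactor ; nFactor = nFactor ; covers = covers ; unique = unique }

module RotationalDesign (D : ℕ) .{{_ : NonZero D}} (slopes baseFactor baseIndex orbitFactors : List ℕ) where

  M : ℕ
  M = 5 * D

  instance
    M-nonZero : NonZero M
    M-nonZero = m*n≢0 5 D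

  half : ℕ
  half = M / 2

  layer : ℕ → ℕ
  layer x = x / M

  residue : ℕ → ℕ
  residue x = x % M

  point : ℕ → ℕ → ℕ
  point l u = M * l + u % M

  translate : ℕ → ℕ → ℕ
  translate a x = point (layer x) (residue x + a)

  -- The c-th triangle of the base factor is entries 3c, 3c+1, 3c+2 of baseFactor,
  -- and baseIndex is the inverse permutation.
  translatedBase : ℕ → CycleTable
  translatedBase a = record
    { cycles   = M
    ; vertex   = λ c i → translate a (entry baseFactor (3 * c + i))
    ; cycleOf  = λ x → entry baseIndex (translate (M ∸ a) x) / 3
    ; position = λ x → entry baseIndex (translate (M ∸ a) x) % 3
    }

  transversals : ℕ → CycleTable
  transversals s = record
    { cycles   = M
    ; vertex   = λ c l → point l (c + l * s)
    ; cycleOf  = λ x → (residue x + layer x * (M ∸ s)) % M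
    ; position = layer
    }

  cosets : CycleTable
  cosets = record
    { cycles   = 3 * D
    ; vertex   = λ c i → point (c / D) (c % D + D * i)
    ; cycleOf  = λ x → layer x * D + residue x % D
    ; position = λ x → residue x / D
    }

  difference : ℕ → ℕ → ℕ
  difference u w = (w + M ∸ u) % M

  -- Entry o of orbitFactors describes the o-th Z_M-orbit of edges: a value e < M says
  -- that the base factor contains the edge of the orbit starting at residue e, so the
  -- edge starting at u lies in the translate by u − e; a value e ≥ M names the
  -- translation-invariant factor containing the whole orbit.
  orbitFactor : ℕ → ℕ → ℕ
  orbitFactor o u = if e <ᵇ M then (u + M ∸ e) % M else e
    where e = entry orbitFactors o

  layerPair : ℕ → ℕ → ℕ
  layerPair 0 1 = 0
  layerPair 1 2 = 1
  layerPair _ _ = 2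

  -- Orbits inside layer l, of differences ±d with 1 ≤ d ≤ half, are numbered l * half + d − 1;
  -- orbits between layers l < l′, of difference d, follow them.
  labelFromLowerLayer : ℕ → ℕ → ℕ
  labelFromLowerLayer x y =
    if layer x ≡ᵇ layer y
    then (if d ≤ᵇ half then orbitFactor (layer x * half + d ∸ 1) (residue x)
          else orbitFactor (layer x * half + (M ∸ d) ∸ 1) (residue y))
    else orbitFactor (3 * half + layerPair (layer x) (layer y) * M + d) (residue x)
    where d = difference (residue x) (residue y)

  label : ℕ → ℕ → ℕ
  label x y = if layer y <ᵇ layer x then labelFromLowerLayer y x else labelFromLowerLayer x y

  certificate : FactorizationCertificate (3 * M) 3 5 (M + length slopes) 1
  certificate = record
    { mTable = λ a → if a <ᵇ M then translatedBase a else transversals (entry slopes (a ∸ M))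
    ; nTable = λ _ → cosets
    ; label  = label
    }

slopes75 : List ℕ
slopes75 =
  4 ∷ 18 ∷ 2 ∷ 8 ∷ 3 ∷ 15 ∷ 14 ∷ 19 ∷ 12 ∷ 6 ∷ 1 ∷ []

baseFactor75 : List ℕ
baseFactor75 =
  10 ∷ 26 ∷ 61 ∷ 21 ∷ 24 ∷ 64 ∷ 15 ∷ 22 ∷ 35 ∷ 0 ∷ 8 ∷ 19 ∷ 2 ∷ 6 ∷ 27 ∷
  4 ∷ 20 ∷ 68 ∷ 16 ∷ 17 ∷ 39 ∷ 3 ∷ 5 ∷ 18 ∷ 23 ∷ 55 ∷ 73 ∷ 12 ∷ 47 ∷ 54 ∷
  9 ∷ 45 ∷ 56 ∷ 14 ∷ 38 ∷ 48 ∷ 1 ∷ 31 ∷ 33 ∷ 13 ∷ 30 ∷ 72 ∷ 11 ∷ 57 ∷ 71 ∷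
  7 ∷ 51 ∷ 52 ∷ 40 ∷ 60 ∷ 62 ∷ 59 ∷ 63 ∷ 69 ∷ 58 ∷ 67 ∷ 70 ∷ 36 ∷ 66 ∷ 74 ∷
  41 ∷ 42 ∷ 65 ∷ 25 ∷ 34 ∷ 50 ∷ 32 ∷ 44 ∷ 53 ∷ 29 ∷ 37 ∷ 43 ∷ 28 ∷ 46 ∷ 49 ∷ []

baseIndex75 : List ℕ
baseIndex75 =
  9 ∷ 36 ∷ 12 ∷ 21 ∷ 15 ∷ 22 ∷ 13 ∷ 45 ∷ 10 ∷ 30 ∷ 0 ∷ 42 ∷ 27 ∷ 39 ∷ 33 ∷
  6 ∷ 18 ∷ 19 ∷ 23 ∷ 11 ∷ 16 ∷ 3 ∷ 7 ∷ 24 ∷ 4 ∷ 63 ∷ 1 ∷ 14 ∷ 72 ∷ 69 ∷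
  40 ∷ 37 ∷ 66 ∷ 38 ∷ 64 ∷ 8 ∷ 57 ∷ 70 ∷ 34 ∷ 20 ∷ 48 ∷ 60 ∷ 61 ∷ 71 ∷ 67 ∷
  31 ∷ 73 ∷ 28 ∷ 35 ∷ 74 ∷ 65 ∷ 46 ∷ 47 ∷ 68 ∷ 29 ∷ 25 ∷ 32 ∷ 43 ∷ 54 ∷ 51 ∷
  49 ∷ 2 ∷ 50 ∷ 52 ∷ 5 ∷ 62 ∷ 58 ∷ 55 ∷ 17 ∷ 53 ∷ 56 ∷ 44 ∷ 41 ∷ 26 ∷ 59 ∷ []

orbitFactors75 : List ℕ
orbitFactors75 =
  16 ∷ 3 ∷ 21 ∷ 2 ∷ 36 ∷ 19 ∷ 15 ∷ 0 ∷ 20 ∷ 18 ∷ 8 ∷ 18 ∷ 16 ∷ 6 ∷ 21 ∷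
  24 ∷ 36 ∷ 12 ∷ 21 ∷ 4 ∷ 0 ∷ 13 ∷ 18 ∷ 7 ∷ 1 ∷ 10 ∷ 17 ∷ 9 ∷ 36 ∷ 13 ∷
  23 ∷ 16 ∷ 8 ∷ 9 ∷ 21 ∷ 8 ∷ 2 ∷ 35 ∷ 27 ∷ 29 ∷ 25 ∷ 1 ∷ 34 ∷ 1 ∷ 28 ∷
  14 ∷ 12 ∷ 9 ∷ 33 ∷ 22 ∷ 31 ∷ 30 ∷ 10 ∷ 13 ∷ 26 ∷ 32 ∷ 15 ∷ 6 ∷ 17 ∷ 16 ∷
  14 ∷ 0 ∷ 35 ∷ 27 ∷ 29 ∷ 25 ∷ 11 ∷ 34 ∷ 22 ∷ 28 ∷ 19 ∷ 1 ∷ 20 ∷ 33 ∷ 11 ∷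
  31 ∷ 30 ∷ 9 ∷ 5 ∷ 26 ∷ 32 ∷ 15 ∷ 7 ∷ 15 ∷ 17 ∷ 16 ∷ 23 ∷ 10 ∷ 35 ∷ 31 ∷
  27 ∷ 30 ∷ 29 ∷ 23 ∷ 25 ∷ 13 ∷ 11 ∷ 26 ∷ 34 ∷ 32 ∷ 4 ∷ 24 ∷ 28 ∷ 12 ∷ 21 ∷
  7 ∷ 7 ∷ 11 ∷ 9 ∷ 20 ∷ 33 ∷ []

slopes105 : List ℕ
slopes105 =
  8 ∷ 4 ∷ 16 ∷ 7 ∷ 15 ∷ 24 ∷ 14 ∷ 30 ∷ 20 ∷ 12 ∷ 6 ∷ 3 ∷ 27 ∷ 0 ∷ 25 ∷
  13 ∷ []

baseFactor105 : List ℕ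
baseFactor105 =
  11 ∷ 79 ∷ 92 ∷ 5 ∷ 78 ∷ 104 ∷ 74 ∷ 80 ∷ 101 ∷ 67 ∷ 76 ∷ 86 ∷ 94 ∷ 95 ∷ 97 ∷
  21 ∷ 83 ∷ 98 ∷ 42 ∷ 71 ∷ 75 ∷ 19 ∷ 77 ∷ 88 ∷ 17 ∷ 70 ∷ 89 ∷ 25 ∷ 91 ∷ 96 ∷
  36 ∷ 81 ∷ 93 ∷ 56 ∷ 73 ∷ 90 ∷ 2 ∷ 3 ∷ 82 ∷ 16 ∷ 20 ∷ 72 ∷ 26 ∷ 63 ∷ 100 ∷
  37 ∷ 45 ∷ 103 ∷ 39 ∷ 41 ∷ 102 ∷ 44 ∷ 66 ∷ 84 ∷ 9 ∷ 53 ∷ 99 ∷ 51 ∷ 55 ∷ 87 ∷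
  28 ∷ 64 ∷ 85 ∷ 50 ∷ 62 ∷ 68 ∷ 12 ∷ 40 ∷ 43 ∷ 35 ∷ 49 ∷ 69 ∷ 38 ∷ 48 ∷ 57 ∷
  18 ∷ 47 ∷ 58 ∷ 8 ∷ 60 ∷ 65 ∷ 13 ∷ 23 ∷ 46 ∷ 15 ∷ 27 ∷ 61 ∷ 6 ∷ 33 ∷ 59 ∷
  7 ∷ 31 ∷ 52 ∷ 0 ∷ 22 ∷ 54 ∷ 10 ∷ 24 ∷ 29 ∷ 1 ∷ 4 ∷ 30 ∷ 14 ∷ 32 ∷ 34 ∷ []

baseIndex105 : List ℕ
baseIndex105 =
  93 ∷ 99 ∷ 36 ∷ 37 ∷ 100 ∷ 3 ∷ 87 ∷ 90 ∷ 78 ∷ 54 ∷ 96 ∷ 0 ∷ 66 ∷ 81 ∷ 102 ∷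
  84 ∷ 39 ∷ 24 ∷ 75 ∷ 21 ∷ 40 ∷ 15 ∷ 94 ∷ 82 ∷ 97 ∷ 27 ∷ 42 ∷ 85 ∷ 60 ∷ 98 ∷
  101 ∷ 91 ∷ 103 ∷ 88 ∷ 104 ∷ 69 ∷ 30 ∷ 45 ∷ 72 ∷ 48 ∷ 67 ∷ 49 ∷ 18 ∷ 68 ∷ 51 ∷
  46 ∷ 83 ∷ 76 ∷ 73 ∷ 70 ∷ 63 ∷ 57 ∷ 92 ∷ 55 ∷ 95 ∷ 58 ∷ 33 ∷ 74 ∷ 77 ∷ 89 ∷
  79 ∷ 86 ∷ 64 ∷ 43 ∷ 61 ∷ 80 ∷ 52 ∷ 9 ∷ 65 ∷ 71 ∷ 25 ∷ 19 ∷ 41 ∷ 34 ∷ 6 ∷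
  20 ∷ 10 ∷ 22 ∷ 4 ∷ 1 ∷ 7 ∷ 31 ∷ 38 ∷ 16 ∷ 53 ∷ 62 ∷ 11 ∷ 59 ∷ 23 ∷ 26 ∷
  35 ∷ 28 ∷ 2 ∷ 32 ∷ 12 ∷ 13 ∷ 29 ∷ 14 ∷ 17 ∷ 56 ∷ 44 ∷ 8 ∷ 50 ∷ 47 ∷ 5 ∷ []

orbitFactors105 : List ℕ
orbitFactors105 =
  2 ∷ 32 ∷ 1 ∷ 16 ∷ 24 ∷ 30 ∷ 51 ∷ 33 ∷ 30 ∷ 13 ∷ 31 ∷ 15 ∷ 22 ∷ 10 ∷ 34 ∷
  29 ∷ 32 ∷ 34 ∷ 4 ∷ 5 ∷ 16 ∷ 25 ∷ 27 ∷ 51 ∷ 2 ∷ 13 ∷ 3 ∷ 12 ∷ 15 ∷ 31 ∷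
  0 ∷ 34 ∷ 22 ∷ 33 ∷ 24 ∷ 25 ∷ 24 ∷ 1 ∷ 21 ∷ 4 ∷ 51 ∷ 31 ∷ 34 ∷ 6 ∷ 7 ∷
  11 ∷ 9 ∷ 31 ∷ 13 ∷ 19 ∷ 3 ∷ 48 ∷ 28 ∷ 26 ∷ 46 ∷ 36 ∷ 18 ∷ 45 ∷ 38 ∷ 35 ∷
  9 ∷ 7 ∷ 15 ∷ 44 ∷ 50 ∷ 41 ∷ 39 ∷ 37 ∷ 8 ∷ 6 ∷ 0 ∷ 43 ∷ 31 ∷ 8 ∷ 23 ∷
  40 ∷ 49 ∷ 33 ∷ 47 ∷ 12 ∷ 18 ∷ 42 ∷ 12 ∷ 22 ∷ 13 ∷ 27 ∷ 48 ∷ 16 ∷ 28 ∷ 46 ∷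
  36 ∷ 9 ∷ 45 ∷ 38 ∷ 35 ∷ 32 ∷ 1 ∷ 18 ∷ 44 ∷ 50 ∷ 41 ∷ 39 ∷ 37 ∷ 21 ∷ 31 ∷
  32 ∷ 43 ∷ 29 ∷ 1 ∷ 10 ∷ 40 ∷ 49 ∷ 6 ∷ 47 ∷ 4 ∷ 7 ∷ 42 ∷ 2 ∷ 20 ∷ 7 ∷
  21 ∷ 48 ∷ 25 ∷ 17 ∷ 5 ∷ 26 ∷ 43 ∷ 46 ∷ 21 ∷ 36 ∷ 3 ∷ 2 ∷ 11 ∷ 45 ∷ 40 ∷
  38 ∷ 49 ∷ 35 ∷ 20 ∷ 17 ∷ 47 ∷ 9 ∷ 16 ∷ 28 ∷ 19 ∷ 44 ∷ 42 ∷ 50 ∷ 21 ∷ 41 ∷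
  5 ∷ 39 ∷ 25 ∷ 37 ∷ 11 ∷ 19 ∷ []

module Design75  = RotationalDesign 5 slopes75 baseFactor75 baseIndex75 orbitFactors75
module Design105 = RotationalDesign 7 slopes105 baseFactor105 baseIndex105 orbitFactors105

lemma4p2 : (v : ℕ) → (v ≡ 75) ⊎ (v ≡ 105) →
    TwoFactorization v 3 5 ((v ∸ 3) / 2) 1
lemma4p2 v (inj₁ refl) = FactorizationSound.factorization Design75.certificate tt
lemma4p2 v (inj₂ refl) = FactorizationSound.factorization Design105.certificate tt
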